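{- Let $T$ be a finite nonempty set of tiles. The grid $\mathfrak G$ is not $T$-tilable iff the $\{H,V\}$-reduct of every striped gridlike structure is not $T$-tilable.
   Context: The grid is $\mathfrak G=(\mathbb N^2,V,H)$ with $V=\{((i,j),(i,j+1))\}$, $H=\{((i,j),(i+1,j))\}$ ($i,j\in\mathbb N$). A tile type is $t:\{0,1,2,3\}\to\mathbb N$; the corresponding unary symbol $P_t$ (a tile) has top, right, bottom, left colours $t(0),t(1),t(2),t(3)$. For a finite nonempty set $T$ of tiles, $(A,V,H)$ is $T$-tilable if it has an expansion to $\{H,V\}\cup T$ such that every point lies in exactly one $P_t\in T$, if $H(u,v)$, $P_t(u)$, $P_s(v)$ then the right colour of $P_t$ equals the left colour of $P_s$, and if $V(u,v)$, $P_t(u)$, $P_s(v)$ then the top colour of $P_t$ equals the bottom colour of $P_s$. $(A,V,H)$ is gridlike if $V$ and $H$ are serial and whenever $V(a,b)$, $H(b,c)$, $H(a,b')$, $V(b',c')$ then $c=c'$. A $\{V,H,U,P,Q,C\}$-structure ($U,P,Q,C$ unary) is striped and gridlike if its $\{V,H\}$-reduct is gridlike, $P$ and $Q$ are distinct singletons, $U=P\cup Q$, and for all $a,b$: $H(a,b)$ implies ($C(a)\Leftrightarrow C(b)$), and $V(a,b)$ implies ($C(a)\Leftrightarrow\neg C(b)$). -}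

module Defs where

open import Level using (_⊔_)
open import Data.Nat using (ℕ; suc)
open import Data.Fin using (Fin; zero; suc)
open import Data.Product using (Σ; ∃; _×_; _,_)
open import Data.Sum using (_⊎_)
open import Data.List using (List; _∷_)
open import Data.List.Membership.Propositional using (_∈_)
open import Relation.Nullary using (¬_)
open import Relation.Binary.PropositionalEquality using (_≡_)

Tile : Set
Tile = Fin 4 → ℕ

top right bottom left : Tile → ℕ
top    t = t zero
right  t = t (suc zero)
bottom t = t (suc (suc zero))
left   t = t (suc (suc (suc zero)))

record TileSet : Set where
  constructor tileSet
  field
    tiles    : List Tile
    nonempty : ∃ λ t → t ∈ tiles
open TileSet public

record VHStructure : Set₁ where
  constructor vh
  field
    Carrier : Set
    V H     : Carrier → Carrier → Set
open VHStructure public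

-- T-tilable: an expansion by the tile predicates P_t (t ∈ T) such that every
-- point lies in exactly one P_t, i.e. a function assigning to each point a tile
-- of T, satisfying the colour-matching conditions.
Tilable : TileSet → VHStructure → Set
Tilable T S =
  Σ (Carrier S → Tile) λ τ →
      (∀ a → τ a ∈ tiles T)
    × (∀ u v → H S u v → right (τ u) ≡ left (τ v))
    × (∀ u v → V S u v → top (τ u) ≡ bottom (τ v))

Grid : VHStructure
Grid = vh (ℕ × ℕ)
          (λ { (i , j) (i' , j') → (i' ≡ i) × (j' ≡ suc j) })
          (λ { (i , j) (i' , j') → (i' ≡ suc i) × (j' ≡ j) })

Serial : {A : Set} → (A → A → Set) → Set
Serial {A} R = ∀ a → ∃ λ b → R a b

Gridlike : VHStructure → Set
Gridlike S =
    Serial (V S) × Serial (H S)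
  × (∀ a b c b' c' → V S a b → H S b c → H S a b' → V S b' c' → c ≡ c')

record VHUPQCStructure : Set₁ where
  field
    reduct     : VHStructure
    U P Q C    : Carrier reduct → Set
open VHUPQCStructure public

Singleton : {A : Set} → (A → Set) → Set
Singleton {A} X = ∃ λ a → X a × (∀ b → X b → b ≡ a)

_⇔′_ : ∀ {a b} → Set a → Set b → Set (a ⊔ b)
X ⇔′ Y = (X → Y) × (Y → X)

StripedGridlike : VHUPQCStructure → Set
StripedGridlike S =
    Gridlike (reduct S)
  × Singleton (P S) × Singleton (Q S)
  × ¬ (∀ a → P S a ⇔′ Q S a)
  × (∀ a → U S a ⇔′ (P S a ⊎ Q S a))
  × (∀ a b → H (reduct S) a b → C S a ⇔′ C S b)
  × (∀ a b → V (reduct S) a b → C S a ⇔′ (¬ C S b))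

module Submission where

-- Tilability is reflected along homomorphisms: if f : A → B maps
-- H-edges to H-edges and V-edges to V-edges, then every T-tiling of B pulls
-- back to a T-tiling of A.  The grid is the "free" gridlike structure: in a
-- gridlike structure with a chosen point a, fix an H-successor and a
-- V-successor of every point; the gridlike square condition makes the chosen
-- H-successor map send V-edges to V-edges, so (i , j) ↦ east^i (north^j a)
-- is a homomorphism from the grid.
--   (⇒) A striped gridlike structure has a point (its P-element), hence
--       receives a homomorphism from the grid; a tiling of it would pull back
--       to a tiling of the grid.
--   (⇐) The grid itself, with P = {(0,0)}, Q = {(0,1)} and C the rows of
--       even height, is striped gridlike; so a tiling of the grid is a tiling
--       of the reduct of a striped gridlike structure.

open import Defs
open import Data.Nat using (ℕ; zero; suc; parity)
open import Data.Nat.GeneralisedArithmetic using (fold)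
open import Data.Parity.Base using (0ℙ; 1ℙ; _⁻¹)
open import Data.Parity.Properties using (suc-homo-⁻¹)
open import Data.Product using (_×_; _,_; proj₁; proj₂)
open import Data.Sum using (_⊎_)
open import Function using (id)
open import Relation.Nullary using (¬_; contradiction)
open import Relation.Binary.PropositionalEquality using (_≡_; refl; sym; subst)

record Hom (A B : VHStructure) : Set where
  field
    map    : Carrier A → Carrier B
    pres-H : ∀ {u v} → H A u v → H B (map u) (map v)
    pres-V : ∀ {u v} → V A u v → V B (map u) (map v)

tiling-pullback : ∀ {T A B} → Hom A B → Tilable T B → Tilable T A
tiling-pullback f (τ , τ∈T , match-H , match-V) =
    (λ a → τ (map a))
  , (λ a → τ∈T (map a))
  , (λ u v e → match-H (map u) (map v) (pres-H e))
  , (λ u v e → match-V (map u) (map v) (pres-V e))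
  where open Hom f

module GridEmbedding (S : VHStructure) (gridlike : Gridlike S) (origin : Carrier S) where

  V-serial : Serial (V S)
  V-serial = proj₁ gridlike

  H-serial : Serial (H S)
  H-serial = proj₁ (proj₂ gridlike)

  square : ∀ a b c b' c' → V S a b → H S b c → H S a b' → V S b' c' → c ≡ c'
  square = proj₂ (proj₂ gridlike)

  north east : Carrier S → Carrier S
  north a = proj₁ (V-serial a)
  east  a = proj₁ (H-serial a)

  north-V : ∀ a → V S a (north a)
  north-V a = proj₂ (V-serial a)

  east-H : ∀ a → H S a (east a)
  east-H a = proj₂ (H-serial a)

  -- Going east preserves V-edges: by the square condition applied to the
  -- path a →V b →H east b and a →H east a →V north (east a), the point
  -- east b is north (east a).
  east-pres-V : ∀ {a b} → V S a b → V S (east a) (east b)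
  east-pres-V {a} {b} ab = subst (V S (east a)) (sym east-b≡north-east-a) (north-V (east a))
    where
    east-b≡north-east-a : east b ≡ north (east a)
    east-b≡north-east-a =
      square a b (east b) (east a) (north (east a)) ab (east-H b) (east-H a) (north-V (east a))

  east^-pres-V : ∀ i {a b} → V S a b → V S (fold a east i) (fold b east i)
  east^-pres-V zero    ab = ab
  east^-pres-V (suc i) ab = east-pres-V (east^-pres-V i ab)

  position : ℕ × ℕ → Carrier S
  position (i , j) = fold (fold origin north j) east i

  embedding : Hom Grid S
  embedding = record
    { map    = position
    ; pres-H = λ { {i , j} (refl , refl) → east-H (position (i , j)) }
    ; pres-V = λ { {i , j} (refl , refl) → east^-pres-V i (north-V (fold origin north j)) }
    }

StripedGrid : VHUPQCStructure
StripedGrid = record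
  { reduct = Grid
  ; U = λ a → (a ≡ (0 , 0)) ⊎ (a ≡ (0 , 1))
  ; P = λ a → a ≡ (0 , 0)
  ; Q = λ a → a ≡ (0 , 1)
  ; C = λ { (i , j) → parity j ≡ 0ℙ }
  }

grid-gridlike : Gridlike Grid
grid-gridlike =
    (λ { (i , j) → (i , suc j) , refl , refl })
  , (λ { (i , j) → (suc i , j) , refl , refl })
  , (λ { _ _ _ _ _ (refl , refl) (refl , refl) (refl , refl) (refl , refl) → refl })

even-alternates : ∀ j → (parity j ≡ 0ℙ) ⇔′ (¬ parity (suc j) ≡ 0ℙ)
even-alternates j = subst (λ p → (p ≡ 0ℙ) ⇔′ (¬ parity (suc j) ≡ 0ℙ))
                          (suc-homo-⁻¹ j) (flip-even (parity (suc j)))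
  where
  flip-even : ∀ p → (p ⁻¹ ≡ 0ℙ) ⇔′ (¬ p ≡ 0ℙ)
  flip-even 0ℙ = (λ ()) , (λ p≢0 → contradiction refl p≢0)
  flip-even 1ℙ = (λ _ ()) , (λ _ → refl)

striped-grid : StripedGridlike StripedGrid
striped-grid =
    grid-gridlike
  , ((0 , 0) , refl , λ _ b≡00 → b≡00)
  , ((0 , 1) , refl , λ _ b≡01 → b≡01)
  , (λ P⇔Q → origin≢above-origin (proj₁ (P⇔Q (0 , 0)) refl))
  , (λ _ → id , id)
  , (λ { _ _ (refl , refl) → id , id })
  , (λ { (i , j) _ (refl , refl) → even-alternates j })
  where
  origin≢above-origin : ¬ (_≡_ {A = ℕ × ℕ} (0 , 0) (0 , 1))
  origin≢above-origin ()

lemma15 : (T : TileSet) →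
    (¬ Tilable T Grid) ⇔′ (∀ (S : VHUPQCStructure) → StripedGridlike S → ¬ Tilable T (reduct S))
lemma15 T = no-grid-tiling⇒no-striped-tiling , no-striped-tiling⇒no-grid-tiling
  where
  no-grid-tiling⇒no-striped-tiling :
    ¬ Tilable T Grid → ∀ S → StripedGridlike S → ¬ Tilable T (reduct S)
  no-grid-tiling⇒no-striped-tiling ¬grid S (gridlike , (p , _) , _) tiling =
    ¬grid (tiling-pullback {T = T} (GridEmbedding.embedding (reduct S) gridlike p) tiling)

  no-striped-tiling⇒no-grid-tiling :
    (∀ S → StripedGridlike S → ¬ Tilable T (reduct S)) → ¬ Tilable T Grid
  no-striped-tiling⇒no-grid-tiling ¬striped = ¬striped StripedGrid striped-grid
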